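{- Let $G=(V,E)$ be a connected graph with $vol(G)\ge9$. If there exists a subset $A\subset V$ with $cut(A,V\setminus A)=1$ and $|vol(A)-vol(G)/2|\le3$, then $Mcut(G)=Mcut_1(G)$.
   Context: For a graph with vertex degrees $d_v$: $vol(S)=\sum_{v\in S}d_v$, $vol(G)=vol(V)$; $cut(S,T)$ is the number of edges between disjoint $S,T$; $Ncut(S,T)=cut(S,T)(1/vol(S)+1/vol(T))$; $Mcut_j(G)=\min\{Ncut(B,V\setminus B):\emptyset\ne B\subsetneq V,\ cut(B,V\setminus B)=j\}$ (convention $\min\emptyset=+\infty$); $Mcut(G)=\min_{j\ge1}Mcut_j(G)$. -}

module Defs where

open import Data.Bool using (Bool; true; false; _∧_; _∨_; not; if_then_else_)
open import Data.Nat using (ℕ; zero; suc; _+_; _≡ᵇ_)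
open import Data.Fin using (Fin)
import Data.Fin as Fin
import Data.Nat
open import Data.Fin.Subset using (Subset; ∁)
open import Data.Vec using (Vec; []; _∷_; lookup)
open import Data.List using (List; []; _∷_; map; _++_; foldr; upTo)
open import Data.Integer using (+_)
open import Data.Rational using (ℚ; _/_; _⊓_; 0ℚ) renaming (_*_ to _*ℚ_; _+_ to _+ℚ_)
open import Relation.Binary.PropositionalEquality using (_≡_)

record Graph : Set where
  field
    n     : ℕ
    adj   : Fin n → Fin n → Bool
    sym   : ∀ u v → adj u v ≡ adj v u
    irrefl : ∀ v → adj v v ≡ false
open Graph public

ΣFin : (k : ℕ) → (Fin k → ℕ) → ℕ
ΣFin zero    f = 0
ΣFin (suc k) f = f Fin.zero + ΣFin k (λ i → f (Fin.suc i))

b2n : Bool → ℕ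
b2n true  = 1
b2n false = 0

deg : (G : Graph) → Fin (n G) → ℕ
deg G v = ΣFin (n G) (λ u → b2n (adj G v u))

vol : (G : Graph) → Subset (n G) → ℕ
vol G S = ΣFin (n G) (λ v → if lookup S v then deg G v else 0)

volG : Graph → ℕ
volG G = ΣFin (n G) (λ v → deg G v)

-- cut(S,T): number of edges with one end in S and the other in T
-- (for disjoint S, T each such edge is counted exactly once)
cut : (G : Graph) → Subset (n G) → Subset (n G) → ℕ
cut G S T = ΣFin (n G) (λ u → ΣFin (n G) (λ v →
              b2n (lookup S u ∧ lookup T v ∧ adj G u v)))

data Reach (G : Graph) : Fin (n G) → Fin (n G) → Set where
  here : ∀ {u} → Reach G u u
  step : ∀ {u v w} → adj G u v ≡ true → Reach G v w → Reach G u w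

Connected : Graph → Set
Connected G = ∀ u v → Reach G u v

-- 1/k in ℚ; convention 1/0 = 0 (never used for the graphs of the lemma,
-- where every nonempty vertex set has positive volume)
inv : ℕ → ℚ
inv zero    = 0ℚ
inv (suc k) = (+ 1) / suc k

ℕtoℚ : ℕ → ℚ
ℕtoℚ k = (+ k) / 1

Ncut : (G : Graph) → Subset (n G) → Subset (n G) → ℚ
Ncut G S T = ℕtoℚ (cut G S T) *ℚ (inv (vol G S) +ℚ inv (vol G T))

data ℚ∞ : Set where
  fin : ℚ → ℚ∞
  ∞   : ℚ∞

min∞ : ℚ∞ → ℚ∞ → ℚ∞
min∞ ∞ y = y
min∞ x ∞ = x
min∞ (fin p) (fin q) = fin (p ⊓ q)

minList : List ℚ∞ → ℚ∞
minList = foldr min∞ ∞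

allSubsets : (k : ℕ) → List (Subset k)
allSubsets zero    = [] ∷ []
allSubsets (suc k) = map (true ∷_) (allSubsets k) ++ map (false ∷_) (allSubsets k)

anyB : {k : ℕ} → Subset k → Bool
anyB []       = false
anyB (b ∷ bs) = b ∨ anyB bs

properNonempty : {k : ℕ} → Subset k → Bool
properNonempty B = anyB B ∧ anyB (∁ B)

Mcutⱼ : (G : Graph) → ℕ → ℚ∞
Mcutⱼ G j = minList (map candidate (allSubsets (n G)))
  where
  candidate : Subset (n G) → ℚ∞
  candidate B = if properNonempty B ∧ (cut G B (∁ B) ≡ᵇ j)
                then fin (Ncut G B (∁ B)) else ∞

-- Mcut(G) = min_{j ≥ 1} Mcut_j(G).  Since cut(B,V∖B) ≤ n*n, Mcut_j = +∞
-- for j > n*n, so the minimum over j ∈ {1,…,n*n} is the minimum over all j ≥ 1.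
Mcut : Graph → ℚ∞
Mcut G = minList (map (Mcutⱼ G) (map suc (upTo (n G Data.Nat.* n G))))

module Submission where

-- Write m = vol(G), a = vol(A), a' = vol(V∖A), so a + a' = m and the
-- hypothesis |a − m/2| ≤ 3 says that a and a' differ by at most 6.  Then
-- Ncut(A, V∖A) = m/(a a').  Any B with cut(B, V∖B) = j ≥ 2 has
-- Ncut(B, V∖B) = j m/(b b') with b + b' = m, and j ≤ b, j ≤ b' since a cut never
-- exceeds the volume of either side.  By AM–GM, 4 b b' ≤ m², while balancedness
-- gives m² ≤ 4 a a' + 36; since m ≥ 9 we have 72 ≤ m², hence b b' ≤ 2 a a' ≤ j a a',
-- i.e. Ncut(A, V∖A) ≤ Ncut(B, V∖B).  So Mcut₁(G) ≤ Mcut_j(G) for every j ≥ 2, which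
-- is the theorem.

open import Defs
open import Data.Nat using (ℕ; _≤_)
open import Data.Fin.Subset using (Subset; ∁)
open import Data.Integer using (+_)
open import Data.Rational using (ℚ; _/_; _-_; ∣_∣)
open import Data.Product using (∃; _×_)
open import Relation.Binary.PropositionalEquality using (_≡_)

open import Data.Bool using (Bool; true; false; _∧_; not; if_then_else_; T)
open import Data.Nat using (_<_; zero; suc; _+_; _*_; _∸_; _≡ᵇ_; z≤n; s≤s)
import Data.Nat.Properties as ℕP
open import Data.Nat.Tactic.RingSolver using (solve-∀)
open import Data.Fin using (Fin)
import Data.Fin as Fin
open import Data.Vec using (lookup; []; _∷_)
open import Data.Vec.Properties using (lookup-map)
import Data.Integer as ℤ
import Data.Integer.Properties as ℤP
import Data.Rational as ℚ
open import Data.Rational using (toℚᵘ)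
import Data.Rational.Properties as ℚP
import Data.Rational.Unnormalised as U
import Data.Rational.Unnormalised.Properties as UP
open import Data.Product using (_,_; proj₁; proj₂)
open import Data.Sum using (_⊎_; inj₁; inj₂)
open import Data.Empty using (⊥-elim)
open import Data.Unit using (tt)
open import Data.List using ([]; _∷_; map; upTo; applyUpTo)
open import Data.List.Membership.Propositional using (_∈_)
open import Data.List.Membership.Propositional.Properties using (∈-map⁺; ∈-++⁺ˡ; ∈-++⁺ʳ)
open import Data.List.Relation.Unary.Any using (here; there)
open import Data.List.Relation.Unary.All using (All; []; _∷_; universal)
open import Data.List.Relation.Unary.All.Properties using (map⁺; applyUpTo⁺₂)
open import Relation.Binary.PropositionalEquality
  using (refl; trans; cong; cong₂; subst; subst₂; module ≡-Reasoning)
  renaming (sym to ≡-sym)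

ΣFin-cong : ∀ k {f g : Fin k → ℕ} → (∀ i → f i ≡ g i) → ΣFin k f ≡ ΣFin k g
ΣFin-cong zero    f≡g = refl
ΣFin-cong (suc k) f≡g = cong₂ _+_ (f≡g Fin.zero) (ΣFin-cong k (λ i → f≡g (Fin.suc i)))

ΣFin-mono : ∀ k {f g : Fin k → ℕ} → (∀ i → f i ≤ g i) → ΣFin k f ≤ ΣFin k g
ΣFin-mono zero    f≤g = z≤n
ΣFin-mono (suc k) f≤g = ℕP.+-mono-≤ (f≤g Fin.zero) (ΣFin-mono k (λ i → f≤g (Fin.suc i)))

ΣFin-zero : ∀ k → ΣFin k (λ _ → 0) ≡ 0
ΣFin-zero zero    = refl
ΣFin-zero (suc k) = ΣFin-zero k

ΣFin-positive : ∀ k (f : Fin k → ℕ) → 0 < ΣFin k f → 0 < k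
ΣFin-positive (suc k) f _ = s≤s z≤n

+-interchange : ∀ a b c d → (a + b) + (c + d) ≡ (a + c) + (b + d)
+-interchange = solve-∀

ΣFin-+ : ∀ k (f g : Fin k → ℕ) → ΣFin k f + ΣFin k g ≡ ΣFin k (λ i → f i + g i)
ΣFin-+ zero    f g = refl
ΣFin-+ (suc k) f g =
  trans (+-interchange (f Fin.zero) _ (g Fin.zero) _)
        (cong (_+_ (f Fin.zero + g Fin.zero)) (ΣFin-+ k (λ i → f (Fin.suc i)) (λ i → g (Fin.suc i))))

ΣFin-swap : ∀ k l (f : Fin k → Fin l → ℕ) →
  ΣFin k (λ u → ΣFin l (λ v → f u v)) ≡ ΣFin l (λ v → ΣFin k (λ u → f u v))
ΣFin-swap zero    l f = ≡-sym (ΣFin-zero l)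
ΣFin-swap (suc k) l f =
  trans (cong (_+_ (ΣFin l (f Fin.zero))) (ΣFin-swap k l (λ u → f (Fin.suc u))))
        (ΣFin-+ l (f Fin.zero) (λ v → ΣFin k (λ u → f (Fin.suc u) v)))

-- Every vertex contributes its degree to exactly one of vol(B), vol(V∖B).
vol-∁ : ∀ G B → vol G B + vol G (∁ B) ≡ volG G
vol-∁ G B = trans (ΣFin-+ (n G) _ _) (ΣFin-cong (n G) λ v →
  trans (cong (λ c → (if lookup B v then deg G v else 0) + (if c then deg G v else 0))
              (lookup-map v not B))
        (contribution (lookup B v) (deg G v)))
  where
  contribution : ∀ (b : Bool) d → (if b then d else 0) + (if not b then d else 0) ≡ d
  contribution true  d = ℕP.+-identityʳ d
  contribution false d = refl

-- The edges leaving S are among the edges at vertices of S, so cut(S,T) ≤ vol(S).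
cut≤vol : ∀ G S T → cut G S T ≤ vol G S
cut≤vol G S T = ΣFin-mono (n G) λ u → edges-at u (lookup S u)
  where
  indicator-≤ : ∀ a b → b2n (a ∧ b) ≤ b2n b
  indicator-≤ true  b = ℕP.≤-refl
  indicator-≤ false b = z≤n
  edges-at : ∀ u s → ΣFin (n G) (λ v → b2n (s ∧ lookup T v ∧ adj G u v))
                     ≤ (if s then deg G u else 0)
  edges-at u true  = ΣFin-mono (n G) λ v → indicator-≤ (lookup T v) (adj G u v)
  edges-at u false = ℕP.≤-reflexive (ΣFin-zero (n G))

-- cut(S,T) = cut(T,S), by symmetry of adjacency and exchanging the double sum.
cut-sym : ∀ G S T → cut G S T ≡ cut G T S
cut-sym G S T = trans (ΣFin-swap (n G) (n G) _) (ΣFin-cong (n G) λ v → ΣFin-cong (n G) λ u →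
  cong b2n (trans (∧-swap (lookup S u) (lookup T v) (adj G u v))
                  (cong (λ c → lookup T v ∧ lookup S u ∧ c) (Graph.sym G u v))))
  where
  ∧-swap : ∀ a b c → a ∧ b ∧ c ≡ b ∧ a ∧ c
  ∧-swap true  true  c = refl
  ∧-swap true  false c = refl
  ∧-swap false true  c = refl
  ∧-swap false false c = refl

cut-nonempty : ∀ G S T {k} → cut G S T ≡ suc k → anyB S ≡ true
cut-nonempty G S T {k} cut≡ with anyB S in empty?
... | true  = refl
... | false = ⊥-elim (ℕP.0≢1+n (trans (≡-sym (no-edges empty?)) cut≡))
  where
  absent : ∀ {m} (S : Subset m) → anyB S ≡ false → ∀ v → lookup S v ≡ false
  absent (false ∷ S) e Fin.zero    = refl
  absent (false ∷ S) e (Fin.suc v) = absent S e v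
  no-edges : anyB S ≡ false → cut G S T ≡ 0
  no-edges e = trans (ΣFin-cong (n G) λ u →
      trans (ΣFin-cong (n G) λ v → cong (λ s → b2n (s ∧ lookup T v ∧ adj G u v)) (absent S e u))
            (ΣFin-zero (n G)))
    (ΣFin-zero (n G))

cut-proper : ∀ G A {k} → cut G A (∁ A) ≡ suc k → properNonempty A ≡ true
cut-proper G A cut≡ =
  cong₂ _∧_ (cut-nonempty G A (∁ A) cut≡) (cut-nonempty G (∁ A) A (trans (cut-sym G (∁ A) A) cut≡))

data _≤∞_ (K : ℚ) : ℚ∞ → Set where
  ≤∞-∞   : K ≤∞ ∞
  ≤∞-fin : ∀ {q} → K ℚ.≤ q → K ≤∞ fin q

≤∞-weaken : ∀ {K' K x} → K' ℚ.≤ K → K ≤∞ x → K' ≤∞ x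
≤∞-weaken K'≤K ≤∞-∞        = ≤∞-∞
≤∞-weaken K'≤K (≤∞-fin K≤q) = ≤∞-fin (ℚP.≤-trans K'≤K K≤q)

≤∞-min : ∀ {K x y} → K ≤∞ x → K ≤∞ y → K ≤∞ min∞ x y
≤∞-min ≤∞-∞         K≤y          = K≤y
≤∞-min (≤∞-fin K≤p) ≤∞-∞         = ≤∞-fin K≤p
≤∞-min (≤∞-fin K≤p) (≤∞-fin K≤q) = ≤∞-fin (ℚP.⊓-glb K≤p K≤q)

≤∞-minList : ∀ {K L} → All (K ≤∞_) L → K ≤∞ minList L
≤∞-minList []           = ≤∞-∞
≤∞-minList (K≤x ∷ K≤xs) = ≤∞-min K≤x (≤∞-minList K≤xs)

min∞-absorb : ∀ {K y} → K ≤∞ y → min∞ (fin K) y ≡ fin K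
min∞-absorb ≤∞-∞         = refl
min∞-absorb (≤∞-fin K≤q) = cong fin (ℚP.p≤q⇒p⊓q≡p K≤q)

minList-attains : ∀ {A : Set} (f : A → ℚ∞) L x {K} → x ∈ L → f x ≡ fin K →
  ∃ λ c → minList (map f L) ≡ fin c × c ℚ.≤ K
minList-attains f (y ∷ L) x {K} (here refl) fx≡K rewrite fx≡K with minList (map f L)
... | ∞     = K , refl , ℚP.≤-refl
... | fin q = K ℚ.⊓ q , refl , ℚP.p⊓q≤p K q
minList-attains f (y ∷ L) x (there x∈L) fx≡K with minList-attains f L x x∈L fx≡K
... | c , min≡c , c≤K rewrite min≡c with f y
...   | ∞     = c , refl , c≤K
...   | fin p = p ℚ.⊓ c , refl , ℚP.≤-trans (ℚP.p⊓q≤q p c) c≤K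

allSubsets-complete : ∀ k (S : Subset k) → S ∈ allSubsets k
allSubsets-complete zero    []          = here refl
allSubsets-complete (suc k) (true ∷ S)  =
  ∈-++⁺ˡ (∈-map⁺ (true ∷_) (allSubsets-complete k S))
allSubsets-complete (suc k) (false ∷ S) =
  ∈-++⁺ʳ (map (true ∷_) (allSubsets k)) (∈-map⁺ (false ∷_) (allSubsets-complete k S))

Mcutⱼ-lowerBound : ∀ G j K → (∀ B → cut G B (∁ B) ≡ j → K ℚ.≤ Ncut G B (∁ B)) →
  K ≤∞ Mcutⱼ G j
Mcutⱼ-lowerBound G j K bound =
  ≤∞-minList (map⁺ (universal (λ B → guarded (properNonempty B) B) (allSubsets (n G))))
  where
  guarded : ∀ (proper : Bool) B → K ≤∞ (if proper ∧ (cut G B (∁ B) ≡ᵇ j) then fin (Ncut G B (∁ B)) else ∞)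
  guarded false B = ≤∞-∞
  guarded true  B with cut G B (∁ B) ≡ᵇ j in cut≡ᵇj
  ... | true  = ≤∞-fin (bound B (ℕP.≡ᵇ⇒≡ _ j (subst T (≡-sym cut≡ᵇj) tt)))
  ... | false = ≤∞-∞

Mcutⱼ-attained : ∀ G j B → properNonempty B ≡ true → cut G B (∁ B) ≡ j →
  ∃ λ c → Mcutⱼ G j ≡ fin c × c ℚ.≤ Ncut G B (∁ B)
Mcutⱼ-attained G j B proper cut≡j =
  minList-attains _ (allSubsets (n G)) B (allSubsets-complete (n G) B) candidate-value
  where
  ≡ᵇ-refl : ∀ i → (i ≡ᵇ i) ≡ true
  ≡ᵇ-refl zero    = refl
  ≡ᵇ-refl (suc i) = ≡ᵇ-refl i
  candidate-value :
    (if properNonempty B ∧ (cut G B (∁ B) ≡ᵇ j) then fin (Ncut G B (∁ B)) else ∞) ≡ fin (Ncut G B (∁ B))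
  candidate-value rewrite proper | cut≡j | ≡ᵇ-refl j = refl

min-attained-first : ∀ (g : ℕ → ℚ∞) c M → 1 ≤ M → g 1 ≡ fin c →
  (∀ j → c ≤∞ g (suc (suc j))) → minList (map g (map suc (upTo M))) ≡ g 1
min-attained-first g c (suc M) _ g1≡c later = begin
  min∞ (g 1) rest  ≡⟨ cong (λ x → min∞ x rest) g1≡c ⟩
  min∞ (fin c) rest ≡⟨ min∞-absorb (≤∞-minList (map⁺ (map⁺ (applyUpTo⁺₂ suc M later)))) ⟩
  fin c            ≡⟨ ≡-sym g1≡c ⟩
  g 1              ∎
  where
  open ≡-Reasoning
  rest : ℚ∞
  rest = minList (map g (map suc (applyUpTo suc M)))

Mcut≡Mcut₁ : ∀ G c → 0 < n G → Mcutⱼ G 1 ≡ fin c → (∀ j → c ≤∞ Mcutⱼ G (suc (suc j))) →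
  Mcut G ≡ Mcutⱼ G 1
Mcut≡Mcut₁ G c n>0 = min-attained-first (Mcutⱼ G) c (n G * n G) (ℕP.*-mono-≤ n>0 n>0)

-- The identity behind AM–GM, for y = x + d.
square-of-sum : ∀ x d → (x + (x + d)) * (x + (x + d)) ≡ 4 * (x * (x + d)) + d * d
square-of-sum = solve-∀

square-gap : ∀ x y → ∃ λ d → ((x + y) * (x + y) ≡ 4 * (x * y) + d * d) × (x + d ≡ y ⊎ y + d ≡ x)
square-gap x y with ℕP.≤-total x y
... | inj₁ x≤y = y ∸ x , subst (λ z → (x + z) * (x + z) ≡ 4 * (x * z) + (y ∸ x) * (y ∸ x))
                               x+d≡y (square-of-sum x (y ∸ x)) , inj₁ x+d≡y
  where
  x+d≡y : x + (y ∸ x) ≡ y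
  x+d≡y = ℕP.m+[n∸m]≡n x≤y
... | inj₂ y≤x = x ∸ y , gap , inj₂ y+d≡x
  where
  y+d≡x : y + (x ∸ y) ≡ x
  y+d≡x = ℕP.m+[n∸m]≡n y≤x
  gap : (x + y) * (x + y) ≡ 4 * (x * y) + (x ∸ y) * (x ∸ y)
  gap rewrite ℕP.+-comm x y | ℕP.*-comm x y =
    subst (λ z → (y + z) * (y + z) ≡ 4 * (y * z) + (x ∸ y) * (x ∸ y)) y+d≡x (square-of-sum y (x ∸ y))

am-gm : ∀ x y → 4 * (x * y) ≤ (x + y) * (x + y)
am-gm x y with square-gap x y
... | d , sq≡ , _ = subst (4 * (x * y) ≤_) (≡-sym sq≡) (ℕP.m≤m+n _ (d * d))

difference-bound : ∀ x y d k → x ≤ y + k → y ≤ x + k → (x + d ≡ y ⊎ y + d ≡ x) → d ≤ k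
difference-bound x y d k x≤y+k y≤x+k (inj₁ x+d≡y) =
  ℕP.+-cancelˡ-≤ x d k (subst (_≤ x + k) (≡-sym x+d≡y) y≤x+k)
difference-bound x y d k x≤y+k y≤x+k (inj₂ y+d≡x) =
  ℕP.+-cancelˡ-≤ y d k (subst (_≤ y + k) (≡-sym y+d≡x) x≤y+k)

near-balanced-square : ∀ x y k → x ≤ y + k → y ≤ x + k → (x + y) * (x + y) ≤ 4 * (x * y) + k * k
near-balanced-square x y k x≤y+k y≤x+k with square-gap x y
... | d , sq≡ , diff = subst (_≤ 4 * (x * y) + k * k) (≡-sym sq≡)
                             (ℕP.+-monoʳ-≤ (4 * (x * y)) (ℕP.*-mono-≤ d≤k d≤k))
  where
  d≤k : d ≤ k
  d≤k = difference-bound x y d k x≤y+k y≤x+k diff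

-- Core estimate: if a + a' = b + b' = m ≥ 9 and a, a' differ by at most 6, then
-- b b' ≤ 2 a a'.  Indeed 4bb' ≤ m² and m² ≤ 4aa' + 36, while 72 ≤ m².
product-bound : ∀ a a' b b' → a + a' ≡ b + b' → 9 ≤ a + a' → a ≤ a' + 6 → a' ≤ a + 6 →
  b * b' ≤ 2 * (a * a')
product-bound a a' b b' sums≡ m≥9 a≤ a'≤ =
  ℕP.*-cancelˡ-≤ 4 (ℕP.≤-trans 4bb'≤M (subst (M ≤_) (double P) M≤2P))
  where
  open ℕP.≤-Reasoning
  m M P : ℕ
  m = a + a'
  M = m * m
  P = a * a'
  4bb'≤M : 4 * (b * b') ≤ M
  4bb'≤M = subst (λ s → 4 * (b * b') ≤ s * s) (≡-sym sums≡) (am-gm b b')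
  M≤4P+36 : M ≤ 4 * P + 36
  M≤4P+36 = near-balanced-square a a' 6 a≤ a'≤
  72≤M : 72 ≤ M
  72≤M = ℕP.≤-trans (ℕP.m≤m+n 72 9) (ℕP.*-mono-≤ m≥9 m≥9)
  M≤2P : M ≤ 4 * P + 4 * P
  M≤2P = ℕP.+-cancelʳ-≤ 72 M (4 * P + 4 * P) (begin
    M + 72                   ≤⟨ ℕP.+-monoʳ-≤ M 72≤M ⟩
    M + M                    ≤⟨ ℕP.+-mono-≤ M≤4P+36 M≤4P+36 ⟩
    (4 * P + 36) + (4 * P + 36) ≡⟨ +-interchange (4 * P) 36 (4 * P) 36 ⟩
    (4 * P + 4 * P) + 72     ∎)
  double : ∀ p → 4 * p + 4 * p ≡ 4 * (2 * p)
  double = solve-∀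

-- Every Ncut value has the shape j (1/x + 1/y); for
-- positive x, y it is the fraction j (x + y)/(x y), and such fractions are compared
-- by cross-multiplication, computed in the unnormalised rationals.

-- j (1/(x+1) + 1/(y+1)) as an unnormalised rational.
ncutᵘ : ℕ → ℕ → ℕ → U.ℚᵘ
ncutᵘ j x y = U.mkℚᵘ (+ j) 0 U.* (U.mkℚᵘ (+ 1) x U.+ U.mkℚᵘ (+ 1) y)

toℚᵘ-ncut : ∀ j x y → toℚᵘ (ℕtoℚ j ℚ.* (inv (suc x) ℚ.+ inv (suc y))) U.≃ ncutᵘ j x y
toℚᵘ-ncut j x y = UP.≃-trans (ℚP.toℚᵘ-homo-* (ℕtoℚ j) _)
  (UP.*-cong (ℚP.toℚᵘ-fromℚᵘ (U.mkℚᵘ (+ j) 0))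
     (UP.≃-trans (ℚP.toℚᵘ-homo-+ (inv (suc x)) (inv (suc y)))
        (UP.+-cong (ℚP.toℚᵘ-fromℚᵘ (U.mkℚᵘ (+ 1) x)) (ℚP.toℚᵘ-fromℚᵘ (U.mkℚᵘ (+ 1) y)))))

ncutᵘ-numerator : ∀ j x y → U.↥ (ncutᵘ j x y) ≡ + (j * (suc y + suc x))
ncutᵘ-numerator j x y = begin
  + j ℤ.* (+ 1 ℤ.* + suc y ℤ.+ + 1 ℤ.* + suc x)
    ≡⟨ cong₂ (λ p q → + j ℤ.* (p ℤ.+ q)) (ℤP.*-identityˡ (+ suc y)) (ℤP.*-identityˡ (+ suc x)) ⟩
  + j ℤ.* (+ suc y ℤ.+ + suc x)   ≡⟨ cong (ℤ._*_ (+ j)) (≡-sym (ℤP.pos-+ (suc y) (suc x))) ⟩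
  + j ℤ.* + (suc y + suc x)       ≡⟨ ≡-sym (ℤP.pos-* j (suc y + suc x)) ⟩
  + (j * (suc y + suc x))         ∎
  where open ≡-Reasoning

ncutᵘ-denominator : ∀ j x y → U.↧ (ncutᵘ j x y) ≡ + (suc x * suc y)
ncutᵘ-denominator j x y = cong +_ (ℕP.+-identityʳ (suc x * suc y))

ncutᵘ-cross : ∀ c x y j u v →
  U.↥ (ncutᵘ c x y) ℤ.* U.↧ (ncutᵘ j u v) ≡ + ((c * (suc y + suc x)) * (suc u * suc v))
ncutᵘ-cross c x y j u v =
  trans (cong₂ ℤ._*_ (ncutᵘ-numerator c x y) (ncutᵘ-denominator j u v))
        (≡-sym (ℤP.pos-* (c * (suc y + suc x)) (suc u * suc v)))

ncut-≤ : ∀ c j x y u v → 0 < x → 0 < y → 0 < u → 0 < v →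
  (c * (y + x)) * (u * v) ≤ (j * (v + u)) * (x * y) →
  ℕtoℚ c ℚ.* (inv x ℚ.+ inv y) ℚ.≤ ℕtoℚ j ℚ.* (inv u ℚ.+ inv v)
ncut-≤ c j (suc x) (suc y) (suc u) (suc v) _ _ _ _ cross≤ = ℚP.toℚᵘ-cancel-≤
  (UP.≤-respʳ-≃ (UP.≃-sym (toℚᵘ-ncut j u v)) (UP.≤-respˡ-≃ (UP.≃-sym (toℚᵘ-ncut c x y))
    (U.*≤* (subst₂ ℤ._≤_ (≡-sym (ncutᵘ-cross c x y j u v)) (≡-sym (ncutᵘ-cross j u v c x y))
                         (ℤ.+≤+ cross≤)))))

balanced-positive : ∀ x y → 9 ≤ x + y → y ≤ x + 6 → 0 < x
balanced-positive zero    y 9≤y y≤6 = ⊥-elim (ℕP.<⇒≱ (ℕP.≤-trans (ℕP.m≤m+n 7 2) 9≤y) y≤6)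
balanced-positive (suc x) y _   _   = s≤s z≤n

unit-cut-wins : ∀ j a a' b b' → a + a' ≡ b + b' → 9 ≤ a + a' → a ≤ a' + 6 → a' ≤ a + 6 →
  2 ≤ j → j ≤ b → j ≤ b' →
  ℕtoℚ 1 ℚ.* (inv a ℚ.+ inv a') ℚ.≤ ℕtoℚ j ℚ.* (inv b ℚ.+ inv b')
unit-cut-wins j a a' b b' sums≡ m≥9 a≤ a'≤ 2≤j j≤b j≤b' =
  ncut-≤ 1 j a a' b b' a>0 a'>0 (positive j≤b) (positive j≤b') cross≤
  where
  open ℕP.≤-Reasoning
  a>0 : 0 < a
  a>0 = balanced-positive a a' m≥9 a'≤
  a'>0 : 0 < a'
  a'>0 = balanced-positive a' a (subst (9 ≤_) (ℕP.+-comm a a') m≥9) a≤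
  positive : ∀ {c} → j ≤ c → 0 < c
  positive j≤c = ℕP.≤-trans (s≤s z≤n) (ℕP.≤-trans 2≤j j≤c)
  regroup : ∀ j m p → m * (j * p) ≡ (j * m) * p
  regroup = solve-∀
  cross≤ : (1 * (a' + a)) * (b * b') ≤ (j * (b' + b)) * (a * a')
  cross≤ = begin
    (1 * (a' + a)) * (b * b') ≡⟨ cong (_* (b * b')) (trans (ℕP.*-identityˡ (a' + a)) (ℕP.+-comm a' a)) ⟩
    (a + a') * (b * b')       ≤⟨ ℕP.*-monoʳ-≤ (a + a') (product-bound a a' b b' sums≡ m≥9 a≤ a'≤) ⟩
    (a + a') * (2 * (a * a')) ≤⟨ ℕP.*-monoʳ-≤ (a + a') (ℕP.*-monoˡ-≤ (a * a') 2≤j) ⟩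
    (a + a') * (j * (a * a')) ≡⟨ regroup j (a + a') (a * a') ⟩
    (j * (a + a')) * (a * a') ≡⟨ cong (λ s → (j * s) * (a * a')) (trans sums≡ (ℕP.+-comm b b')) ⟩
    (j * (b' + b)) * (a * a') ∎

⊖-within : ∀ p q k → ℤ.∣ p ℤ.⊖ q ∣ ≤ k → p ≤ q + k × q ≤ p + k
⊖-within p q k dist≤k with ℕP.≤-total p q
... | inj₁ p≤q = ℕP.≤-trans p≤q (ℕP.m≤m+n q k) ,
  ℕP.≤-trans (ℕP.m≤n+m∸n q p) (ℕP.+-monoʳ-≤ p (subst (_≤ k) (ℤP.∣⊖∣-≤ p≤q) dist≤k))
... | inj₂ q≤p =
  ℕP.≤-trans (ℕP.m≤n+m∸n p q)
    (ℕP.+-monoʳ-≤ q (subst (_≤ k) (trans (ℤP.∣m⊖n∣≡∣n⊖m∣ p q) (ℤP.∣⊖∣-≤ q≤p)) dist≤k)) ,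
  ℕP.≤-trans q≤p (ℕP.m≤m+n p k)

-- |a − m/2| ≤ k in ℚ means |2a − m| ≤ 2k in ℤ; the difference a − m/2 is the
-- unnormalised fraction (2a − m)/2.
half-distance : ∀ a m k → ∣ ℕtoℚ a - (+ m) / 2 ∣ ℚ.≤ (+ k) / 1 → ℤ.∣ (a * 2) ℤ.⊖ m ∣ ≤ k * 2
half-distance a m k dist≤k = ℤP.drop‿+≤+ (subst₂ ℤ._≤_ lhs rhs (UP.drop-*≤* dist≤ᵘ))
  where
  differenceᵘ : U.ℚᵘ
  differenceᵘ = U.mkℚᵘ (+ a) 0 U.- U.mkℚᵘ (+ m) 1
  toℚᵘ-difference : toℚᵘ (ℕtoℚ a - (+ m) / 2) U.≃ differenceᵘ
  toℚᵘ-difference = UP.≃-trans (ℚP.toℚᵘ-homo-+ (ℕtoℚ a) (ℚ.- ((+ m) / 2)))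
    (UP.+-cong (ℚP.toℚᵘ-fromℚᵘ (U.mkℚᵘ (+ a) 0))
      (UP.≃-trans (ℚP.toℚᵘ-homo‿- ((+ m) / 2)) (UP.-‿cong (ℚP.toℚᵘ-fromℚᵘ (U.mkℚᵘ (+ m) 1)))))
  dist≤ᵘ : U.∣ differenceᵘ ∣ U.≤ U.mkℚᵘ (+ k) 0
  dist≤ᵘ = UP.≤-respʳ-≃ (ℚP.toℚᵘ-fromℚᵘ (U.mkℚᵘ (+ k) 0))
    (UP.≤-respˡ-≃ (UP.≃-trans (ℚP.toℚᵘ-homo-∣-∣ _) (UP.∣-∣-cong toℚᵘ-difference))
                  (ℚP.toℚᵘ-mono-≤ dist≤k))
  numerator : U.↥ differenceᵘ ≡ (a * 2) ℤ.⊖ m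
  numerator = trans (cong₂ ℤ._+_ (≡-sym (ℤP.pos-* a 2)) (ℤP.*-identityʳ (ℤ.- (+ m))))
                    (ℤP.m-n≡m⊖n (a * 2) m)
  lhs : U.↥ U.∣ differenceᵘ ∣ ℤ.* + 1 ≡ + ℤ.∣ (a * 2) ℤ.⊖ m ∣
  lhs = trans (ℤP.*-identityʳ _) (cong (λ z → + ℤ.∣ z ∣) numerator)
  rhs : + k ℤ.* + 2 ≡ + (k * 2)
  rhs = ≡-sym (ℤP.pos-* k 2)

twice : ∀ a → a * 2 ≡ a + a
twice = solve-∀

balanced-halves : ∀ a a' m → a + a' ≡ m → ∣ ℕtoℚ a - (+ m) / 2 ∣ ℚ.≤ (+ 3) / 1 →
  a ≤ a' + 6 × a' ≤ a + 6
balanced-halves a a' m sum≡m dist≤3 with ⊖-within (a * 2) m 6 (half-distance a m 3 dist≤3)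
... | 2a≤m+6 , m≤2a+6 rewrite ≡-sym sum≡m | twice a =
  ℕP.+-cancelˡ-≤ a a (a' + 6) (subst (a + a ≤_) (ℕP.+-assoc a a' 6) 2a≤m+6) ,
  ℕP.+-cancelˡ-≤ a a' (a + 6) (subst (a + a' ≤_) (ℕP.+-assoc a a 6) m≤2a+6)

unit-cut-minimal : ∀ G A B → cut G A (∁ A) ≡ 1 → 9 ≤ volG G →
  vol G A ≤ vol G (∁ A) + 6 → vol G (∁ A) ≤ vol G A + 6 → 2 ≤ cut G B (∁ B) →
  Ncut G A (∁ A) ℚ.≤ Ncut G B (∁ B)
unit-cut-minimal G A B cutA≡1 m≥9 a≤ a'≤ 2≤cutB =
  subst (ℚ._≤ Ncut G B (∁ B)) (cong (λ k → ℕtoℚ k ℚ.* (inv (vol G A) ℚ.+ inv (vol G (∁ A)))) (≡-sym cutA≡1))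
    (unit-cut-wins (cut G B (∁ B)) (vol G A) (vol G (∁ A)) (vol G B) (vol G (∁ B))
      (trans (vol-∁ G A) (≡-sym (vol-∁ G B))) (subst (9 ≤_) (≡-sym (vol-∁ G A)) m≥9) a≤ a'≤ 2≤cutB
      (cut≤vol G B (∁ B)) (subst (_≤ vol G (∁ B)) (cut-sym G (∁ B) B) (cut≤vol G (∁ B) B)))

lemma10 : (G : Graph) → Connected G → 9 ≤ volG G →
            (∃ λ (A : Subset (n G)) →
               (cut G A (∁ A) ≡ 1)
               × (∣ ℕtoℚ (vol G A) - (+ volG G) / 2 ∣ Data.Rational.≤ (+ 3) / 1)) →
            Mcut G ≡ Mcutⱼ G 1
lemma10 G _ m≥9 (A , cutA≡1 , dist≤3) = Mcut≡Mcut₁ G c has-vertex Mcut₁≡c later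
  where
  balanced : vol G A ≤ vol G (∁ A) + 6 × vol G (∁ A) ≤ vol G A + 6
  balanced = balanced-halves (vol G A) (vol G (∁ A)) (volG G) (vol-∁ G A) dist≤3
  attained : ∃ λ c → Mcutⱼ G 1 ≡ fin c × c ℚ.≤ Ncut G A (∁ A)
  attained = Mcutⱼ-attained G 1 A (cut-proper G A cutA≡1) cutA≡1
  c : ℚ
  c = proj₁ attained
  Mcut₁≡c : Mcutⱼ G 1 ≡ fin c
  Mcut₁≡c = proj₁ (proj₂ attained)
  has-vertex : 0 < n G
  has-vertex = ΣFin-positive (n G) (deg G) (ℕP.≤-trans (s≤s z≤n) m≥9)
  later : ∀ j → c ≤∞ Mcutⱼ G (suc (suc j))
  later j = ≤∞-weaken (proj₂ (proj₂ attained))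
    (Mcutⱼ-lowerBound G (suc (suc j)) (Ncut G A (∁ A)) λ B cutB≡ →
      unit-cut-minimal G A B cutA≡1 m≥9 (proj₁ balanced) (proj₂ balanced)
        (subst (2 ≤_) (≡-sym cutB≡) (s≤s (s≤s z≤n))))
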